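{- Let $\mathbf X=(X,\wedge,\vee,\ast,\to_\ast,t_X,f_X)$ be an odd FL$_e$-algebra and $\mathbf Y=(Y,\wedge,\vee,\star,\to_\star,t_Y,f_Y)$ an involutive FL$_e$-algebra. Then: (1) If $\mathbf W\leq\mathbf V\leq\mathbf X_{\mathbf{gr}}$ and $W\neq V$, then the type III partial lexicographic product $\mathbf X\overset{\to}{\times}_{\mathbf V,\mathbf W}\mathbf Y$ has a gap outside its group part. (2) If $X_{gr}$ is discretely embedded into $X$, $\mathbf V\leq\mathbf X_{\mathbf{gr}}$ and $V\neq X_{gr}$, then the type IV partial lexicographic product $\mathbf X\overset{\to}{\times}_{\mathbf V}\mathbf Y$ (type IV) has a gap outside its group part. (3) If $\mathbf X$ has a gap outside its group part, then for every $\mathbf V\leq \mathbf X_{\mathbf{gr}}$ the type I partial lexicographic product of $\mathbf X,\mathbf V,\mathbf Y$ has a gap outside its group part. (4) If $\mathbf X$ has a gap outside its group part and $X_{gr}$ is discretely embedded into $X$, then the type II partial lexicographic product of $\mathbf X$ and $\mathbf Y$ has a gap outside its group part.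
   Context: An FL$_e$-algebra is a structure $(X,\wedge,\vee,\ast,\to_\ast,t,f)$ such that $(X,\wedge,\vee)$ is a lattice with order $\leq$, $(X,\ast,t)$ is a commutative monoid with unit $t$ which is residuated: $x\ast y\leq z$ iff $x\to_\ast z\geq y$; and $f\in X$ is an arbitrary constant. Put $\neg x=x\to_\ast f$. It is involutive if $\neg\neg x=x$ for all $x$, and odd if it is involutive and $t=f$. The group part $X_{gr}$ is the set of invertible elements of $(X,\ast,t)$; in an odd FL$_e$-algebra it is the universe of a subalgebra $\mathbf X_{\mathbf{gr}}$. For subalgebras, $\mathbf W\leq\mathbf V$ means $\mathbf W$ is a subalgebra of $\mathbf V$. For a chain $X$ and $x\in X$, the predecessor $x_\downarrow$ is the largest element smaller than $x$ if it exists, and $x_\downarrow=x$ otherwise; the successor $x_\uparrow$ is defined dually. $Z\subseteq X$ is discretely embedded into $X$ if for every $x\in Z$: $x\notin\{x_\uparrow,x_\downarrow\}\subseteq Z$. A gap is a pair $x<y$ with no element strictly between them; a gap outside the group part is a gap $x<y$ with neither $x$ nor $y$ invertible. In a general lattice-ordered algebra, "gap" refers to two comparable consecutive elements. Type III (and type I) partial lexicographic product: let $\mathbf X$ be odd, $\mathbf Y$ involutive with residual complements $\neg_\ast,\neg_\star$, and $\mathbf W\leq\mathbf V\leq\mathbf X_{\mathbf{gr}}$. Add to $Y$ a new top element $\top$ which is an annihilator for $\star$, then a new bottom element $\bot$ of $Y\cup\{\top\}$ which is an annihilator; set $\neg_\star\bot=\top$, $\neg_\star\top=\bot$. The universe is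 $(W\times(Y\cup\{\top,\bot\}))\cup((V\setminus W)\times\{\top,\bot\})\cup((X\setminus V)\times\{\bot\})$, ordered by the restriction of the lexicographic order (first coordinate dominant), with coordinatewise monoid operation, unit $(t_X,t_Y)$, constant $(f_X,f_Y)$, and residual $(x_1,y_1)\to(x_2,y_2)=\neg((x_1,y_1)\ast(\neg(x_2,y_2)))$ where $\neg(x,y)=(\neg_\ast x,\bot)$ if $x\notin V$ and $\neg(x,y)=(\neg_\ast x,\neg_\star y)$ if $x\in V$. When $\mathbf W=\mathbf V$ it is called the type I partial lexicographic product of $\mathbf X,\mathbf V,\mathbf Y$. Type IV (and type II) partial lexicographic product: assume $X_{gr}$ is discretely embedded into $X$ and $\mathbf V\leq\mathbf X_{\mathbf{gr}}$. Add to $Y$ a new top element $\top$ which is an annihilator. The universe is $(X\times\{\top\})\cup(V\times Y)$ with the restricted lexicographic order, coordinatewise monoid operation, unit $(t_X,t_Y)$, constant $(f_X,f_Y)$, and residual $(x_1,y_1)\to(x_2,y_2)=\neg((x_1,y_1)\ast\neg(x_2,y_2))$ where $\neg(x,\top)=(\neg_\ast x,\top)$ if $x\notin X_{gr}$, $\neg(x,\top)=((\neg_\ast x)_\downarrow,\top)$ if $x\in X_{gr}$, and $\neg(x,y)=(\neg_\ast x,\neg_\star y)$ if $x\in V$, $y\in Y$. When $\mathbf V=\mathbf X_{\mathbf{gr}}$ it is called the type II partial lexicographic product of $\mathbf X$ and $\mathbf Y$. -}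

module Defs where

open import Level using (0ℓ)
open import Data.Product using (Σ; ∃; ∃-syntax; _×_; _,_; proj₁; proj₂)
open import Data.Sum using (_⊎_)
open import Data.Unit using (⊤; tt)
open import Data.Empty using (⊥)
open import Relation.Nullary using (¬_)
open import Relation.Unary using (Pred; _⊆_)
open import Relation.Binary.PropositionalEquality using (_≡_; _≢_)
open import Algebra.Core using (Op₂)
open import Algebra.Structures using (IsCommutativeMonoid)
open import Algebra.Lattice.Structures using (IsLattice)
open import Function.Bundles using (_⇔_)

record FLe : Set₁ where
  infixr 5 _⇒_
  infixl 7 _∗_
  field
    Carrier : Set
    _∧_ _∨_ _∗_ _⇒_ : Op₂ Carrier
    t f : Carrier
    isLattice : IsLattice _≡_ _∨_ _∧_
    isCommutativeMonoid : IsCommutativeMonoid _≡_ _∗_ t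
    -- residuation:  x ∗ y ≤ z  iff  y ≤ x ⇒ z,  where  a ≤ b  means  a ∧ b ≡ a
    residuated : ∀ x y z → ((x ∗ y) ∧ z ≡ x ∗ y) ⇔ (y ∧ (x ⇒ z) ≡ y)

module _ (A : FLe) where
  open FLe A

  _≤_ : Carrier → Carrier → Set
  x ≤ y = x ∧ y ≡ x

  _<_ : Carrier → Carrier → Set
  x < y = x ≤ y × x ≢ y

  neg : Carrier → Carrier
  neg x = x ⇒ f

  Involutive : Set
  Involutive = ∀ x → neg (neg x) ≡ x

  Odd : Set
  Odd = Involutive × t ≡ f

  Invertible : Pred Carrier 0ℓ
  Invertible x = ∃[ y ] (x ∗ y ≡ t)

  IsSubalgebra : Pred Carrier 0ℓ → Set
  IsSubalgebra S =
    (∀ {x y} → S x → S y → S (x ∧ y)) ×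
    (∀ {x y} → S x → S y → S (x ∨ y)) ×
    (∀ {x y} → S x → S y → S (x ∗ y)) ×
    (∀ {x y} → S x → S y → S (x ⇒ y)) ×
    S t × S f

  SubalgOfGr : Pred Carrier 0ℓ → Set
  SubalgOfGr V = IsSubalgebra V × (V ⊆ Invertible)

  IsPredecessor : Carrier → Carrier → Set
  IsPredecessor x p = p < x × (∀ z → z < x → z ≤ p)

  IsSuccessor : Carrier → Carrier → Set
  IsSuccessor x s = x < s × (∀ z → x < z → s ≤ z)

  -- Z is discretely embedded into X: for x ∈ Z, x ∉ {x↑, x↓} ⊆ Z,
  -- i.e. x has a predecessor and a successor (so x↓ ≠ x ≠ x↑) and both lie in Z.
  DiscretelyEmbedded : Pred Carrier 0ℓ → Set
  DiscretelyEmbedded Z = ∀ x → Z x →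
    (∃[ p ] (IsPredecessor x p × Z p)) × (∃[ s ] (IsSuccessor x s × Z s))

GapOutside : {A : Set} (S : Pred A 0ℓ) (_<ₛ_ : A → A → Set) (Inv : Pred A 0ℓ) → Set
GapOutside {A} S _<ₛ_ Inv =
  ∃[ a ] ∃[ b ] (S a × S b × a <ₛ b × ¬ Inv a × ¬ Inv b ×
                 ¬ (∃[ c ] (S c × a <ₛ c × c <ₛ b)))

HasGapOutsideGroupPart : FLe → Set
HasGapOutsideGroupPart X = GapOutside (λ _ → ⊤) (_<_ X) (Invertible X)

data Ext (Y : Set) : Set where
  botE : Ext Y
  emb  : Y → Ext Y
  topE : Ext Y

module _ (Y : FLe) where
  open FLe Y

  _≤E_ : Ext Carrier → Ext Carrier → Set
  botE  ≤E _     = ⊤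
  emb a ≤E botE  = ⊥
  emb a ≤E emb b = _≤_ Y a b
  emb a ≤E topE  = ⊤
  topE  ≤E topE  = ⊤
  topE  ≤E _     = ⊥

  _⋆E_ : Ext Carrier → Ext Carrier → Ext Carrier
  botE  ⋆E _     = botE
  emb a ⋆E botE  = botE
  emb a ⋆E emb b = emb (a ∗ b)
  emb a ⋆E topE  = topE
  topE  ⋆E botE  = botE
  topE  ⋆E _     = topE

-- A partial lexicographic product is a
-- subset of it; its order is the restriction of the lexicographic order.

module Lex (X Y : FLe) where
  private
    module X = FLe X
    module Y = FLe Y

  P : Set
  P = X.Carrier × Ext Y.Carrier

  _≤L_ : P → P → Set
  (x₁ , e₁) ≤L (x₂ , e₂) = _<_ X x₁ x₂ ⊎ (x₁ ≡ x₂ × _≤E_ Y e₁ e₂)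

  _<L_ : P → P → Set
  p <L q = p ≤L q × p ≢ q

  _∗L_ : P → P → P
  (x₁ , e₁) ∗L (x₂ , e₂) = (X._∗_ x₁ x₂ , _⋆E_ Y e₁ e₂)

  unitL : P
  unitL = (X.t , emb Y.t)

  InvertibleIn : Pred P 0ℓ → Pred P 0ℓ
  InvertibleIn S u = ∃[ v ] (S v × u ∗L v ≡ unitL)

  -- universe of the type III product  X ×→_{V,W} Y :
  --   (W × (Y ∪ {⊤,⊥})) ∪ ((V∖W) × {⊤,⊥}) ∪ ((X∖V) × {⊥})
  UniverseIII : (V W : Pred X.Carrier 0ℓ) → Pred P 0ℓ
  UniverseIII V W (x , botE)  = ⊤
  UniverseIII V W (x , emb y) = W x
  UniverseIII V W (x , topE)  = V x

  -- universe of the type IV product  X ×→_V Y :  (X × {⊤}) ∪ (V × Y)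
  UniverseIV : (V : Pred X.Carrier 0ℓ) → Pred P 0ℓ
  UniverseIV V (x , botE)  = ⊥
  UniverseIV V (x , emb y) = V x
  UniverseIV V (x , topE)  = ⊤

  ProductHasGapOutsideGroupPart : Pred P 0ℓ → Set
  ProductHasGapOutsideGroupPart S = GapOutside S _<L_ (InvertibleIn S)

{-# OPTIONS --safe #-}
module Submission where

-- Elements whose second coordinate is one of the adjoined ⊥, ⊤ are never
-- invertible, since ⊥ and ⊤ absorb every product.  So it suffices to exhibit
-- two consecutive elements of each product with second coordinates in {⊥, ⊤}:
-- (v, ⊥) < (v, ⊤) for v ∈ V ∖ W in type III; (a, ⊥) < (b, ⊥) for a gap a < b
-- of X with a ∉ V in types I and III; (a, ⊤) < (b, ⊤) for a gap a < b of X
-- with b ∉ V in types II and IV, where for type IV one takes b ∈ X_gr ∖ V and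
-- a its predecessor.  Only the order and the absorbing ⊥, ⊤ are involved.

open import Defs
open import Level using (0ℓ)
open import Data.Product using (∃-syntax; _×_; _,_; proj₁; proj₂)
open import Data.Sum using (_⊎_; inj₁; inj₂)
open import Data.Unit using (⊤; tt)
open import Data.Empty using (⊥-elim)
open import Relation.Nullary using (¬_)
open import Relation.Unary using (Pred; _⊆_)
open import Function using (id)
open import Relation.Binary.PropositionalEquality using (_≡_; refl; sym; trans; cong)
open import Algebra.Lattice.Structures using (IsLattice)

module _ (X : FLe) where
  open FLe X using (Carrier; isLattice)

  NoneBetween : Carrier → Carrier → Set
  NoneBetween a b = ¬ (∃[ c ] (_<_ X a c × _<_ X c b))

  ≤-antisym : ∀ {a b} → _≤_ X a b → _≤_ X b a → a ≡ b
  ≤-antisym {a} {b} a≤b b≤a = trans (sym a≤b) (trans (IsLattice.∧-comm isLattice a b) b≤a)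

  <-≤-asym : ∀ {a b} → _<_ X a b → ¬ _≤_ X b a
  <-≤-asym (a≤b , a≢b) b≤a = a≢b (≤-antisym a≤b b≤a)

  noneBetween-refl : ∀ v → NoneBetween v v
  noneBetween-refl v (c , v<c , c<v) = <-≤-asym v<c (proj₁ c<v)

  predecessor⇒noneBetween : ∀ {g p} → IsPredecessor X g p → NoneBetween p g
  predecessor⇒noneBetween (_ , below-g⇒≤p) (c , p<c , c<g) = <-≤-asym p<c (below-g⇒≤p c c<g)

module _ (X Y : FLe) where
  open Lex X Y

  <⇒<L : ∀ {a b e e′} → _<_ X a b → (a , e) <L (b , e′)
  <⇒<L a<b = inj₁ a<b , λ { refl → proj₂ a<b refl }

  botE<LtopE : ∀ v → (v , botE) <L (v , topE)
  botE<LtopE v = inj₂ (refl , tt) , λ ()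

  lex-between : ∀ {a b x} e₁ e e₂ → NoneBetween X a b →
                (a , e₁) ≤L (x , e) → (x , e) ≤L (b , e₂) →
                (a ≡ x × _≤E_ Y e₁ e) ⊎ (x ≡ b × _≤E_ Y e e₂)
  lex-between _ _ _ none (inj₁ a<x) (inj₁ x<b) = ⊥-elim (none (_ , a<x , x<b))
  lex-between _ _ _ _    (inj₁ _)   (inj₂ x≡b) = inj₂ x≡b
  lex-between _ _ _ _    (inj₂ a≡x) _          = inj₁ a≡x

  lex-same-first : ∀ {v x} e₁ e e₂ → (v , e₁) ≤L (x , e) → (x , e) ≤L (v , e₂) → v ≡ x
  lex-same-first e₁ e e₂ p≤c c≤q with lex-between e₁ e e₂ (noneBetween-refl X _) p≤c c≤q
  ... | inj₁ (v≡x , _) = v≡x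
  ... | inj₂ (x≡v , _) = sym x≡v

  ⋆E≡emb⇒emb : ∀ e e′ {u} → _⋆E_ Y e e′ ≡ emb u → ∃[ y ] (e ≡ emb y)
  ⋆E≡emb⇒emb botE    _        ()
  ⋆E≡emb⇒emb (emb y) _        _  = y , refl
  ⋆E≡emb⇒emb topE    botE     ()
  ⋆E≡emb⇒emb topE    (emb _)  ()
  ⋆E≡emb⇒emb topE    topE     ()

  invertible⇒emb : ∀ {S} x e → InvertibleIn S (x , e) → ∃[ y ] (e ≡ emb y)
  invertible⇒emb x e ((_ , e′) , _ , e∗e′≡t) = ⋆E≡emb⇒emb e e′ (cong proj₂ e∗e′≡t)

  botE-nonInvertible : ∀ S x → ¬ InvertibleIn S (x , botE)
  botE-nonInvertible S x inv with invertible⇒emb x botE inv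
  ... | _ , ()

  topE-nonInvertible : ∀ S x → ¬ InvertibleIn S (x , topE)
  topE-nonInvertible S x inv with invertible⇒emb x topE inv
  ... | _ , ()

  typeIII-noneBetween-vertical : ∀ {V W v} → ¬ W v →
    ¬ (∃[ c ] (UniverseIII V W c × (v , botE) <L c × c <L (v , topE)))
  typeIII-noneBetween-vertical ¬Wv ((x , e) , Sc , (p≤c , p≢c) , (c≤q , c≢q))
    with lex-same-first botE e topE p≤c c≤q
  typeIII-noneBetween-vertical ¬Wv ((x , botE)  , Sc , (_ , p≢c) , _) | refl = p≢c refl
  typeIII-noneBetween-vertical ¬Wv ((x , emb y) , Sc , _ , _)         | refl = ¬Wv Sc
  typeIII-noneBetween-vertical ¬Wv ((x , topE)  , Sc , _ , (_ , c≢q)) | refl = c≢q refl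

  typeIII-noneBetween-bottoms : ∀ {V W a b} → W ⊆ V → ¬ V a → NoneBetween X a b →
    ¬ (∃[ c ] (UniverseIII V W c × (a , botE) <L c × c <L (b , botE)))
  typeIII-noneBetween-bottoms _ _ none ((x , botE) , _ , (p≤c , p≢c) , (c≤q , c≢q))
    with lex-between botE botE botE none p≤c c≤q
  ... | inj₁ (refl , _) = p≢c refl
  ... | inj₂ (refl , _) = c≢q refl
  typeIII-noneBetween-bottoms W⊆V ¬Va none ((x , emb y) , Sc , (p≤c , _) , (c≤q , _))
    with lex-between botE (emb y) botE none p≤c c≤q
  ... | inj₁ (refl , _) = ¬Va (W⊆V Sc)
  ... | inj₂ (refl , ())
  typeIII-noneBetween-bottoms _ ¬Va none ((x , topE) , Sc , (p≤c , _) , (c≤q , _))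
    with lex-between botE topE botE none p≤c c≤q
  ... | inj₁ (refl , _) = ¬Va Sc
  ... | inj₂ (refl , ())

  typeIV-noneBetween-tops : ∀ {V a b} → ¬ V b → NoneBetween X a b →
    ¬ (∃[ c ] (UniverseIV V c × (a , topE) <L c × c <L (b , topE)))
  typeIV-noneBetween-tops _ _ ((x , botE) , () , _)
  typeIV-noneBetween-tops ¬Vb none ((x , emb y) , Sc , (p≤c , _) , (c≤q , _))
    with lex-between topE (emb y) topE none p≤c c≤q
  ... | inj₁ (refl , ())
  ... | inj₂ (refl , _) = ¬Vb Sc
  typeIV-noneBetween-tops _ none ((x , topE) , _ , (p≤c , p≢c) , (c≤q , c≢q))
    with lex-between topE topE topE none p≤c c≤q
  ... | inj₁ (refl , _) = p≢c refl
  ... | inj₂ (refl , _) = c≢q refl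

  typeIII-gap-vertical : ∀ {V W v} → V v → ¬ W v →
    ProductHasGapOutsideGroupPart (UniverseIII V W)
  typeIII-gap-vertical {v = v} Vv ¬Wv =
    (v , botE) , (v , topE) , tt , Vv , botE<LtopE v ,
    botE-nonInvertible _ v , topE-nonInvertible _ v , typeIII-noneBetween-vertical ¬Wv

  typeIII-gap-bottoms : ∀ {V W a b} → W ⊆ V → ¬ V a → _<_ X a b → NoneBetween X a b →
    ProductHasGapOutsideGroupPart (UniverseIII V W)
  typeIII-gap-bottoms {a = a} {b} W⊆V ¬Va a<b none =
    (a , botE) , (b , botE) , tt , tt , <⇒<L a<b ,
    botE-nonInvertible _ a , botE-nonInvertible _ b , typeIII-noneBetween-bottoms W⊆V ¬Va none

  typeIV-gap-tops : ∀ {V a b} → ¬ V b → _<_ X a b → NoneBetween X a b →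
    ProductHasGapOutsideGroupPart (UniverseIV V)
  typeIV-gap-tops {a = a} {b} ¬Vb a<b none =
    (a , topE) , (b , topE) , tt , tt , <⇒<L a<b ,
    topE-nonInvertible _ a , topE-nonInvertible _ b , typeIV-noneBetween-tops ¬Vb none

proposition1 : (X Y : FLe) → Odd X → Involutive Y →
    -- (1) type III
    ((V W : Pred (FLe.Carrier X) 0ℓ) →
      SubalgOfGr X V → IsSubalgebra X W → W ⊆ V →
      ∃[ v ] (V v × ¬ W v) →
      Lex.ProductHasGapOutsideGroupPart X Y (Lex.UniverseIII X Y V W))
    ×
    -- (2) type IV
    (DiscretelyEmbedded X (Invertible X) →
      (V : Pred (FLe.Carrier X) 0ℓ) →
      SubalgOfGr X V →
      ∃[ g ] (Invertible X g × ¬ V g) →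
      Lex.ProductHasGapOutsideGroupPart X Y (Lex.UniverseIV X Y V))
    ×
    -- (3) type I  (type III with W = V)
    (HasGapOutsideGroupPart X →
      (V : Pred (FLe.Carrier X) 0ℓ) →
      SubalgOfGr X V →
      Lex.ProductHasGapOutsideGroupPart X Y (Lex.UniverseIII X Y V V))
    ×
    -- (4) type II  (type IV with V = X_gr)
    (HasGapOutsideGroupPart X →
      DiscretelyEmbedded X (Invertible X) →
      Lex.ProductHasGapOutsideGroupPart X Y (Lex.UniverseIV X Y (Invertible X)))
proposition1 X Y _ _ =
  (λ _ _ _ _ _ (_ , Vv , ¬Wv) → typeIII-gap-vertical X Y Vv ¬Wv) ,
  (λ discrete _ _ (g , g∈gr , ¬Vg) →
     let (_ , g↓p , _) = proj₁ (discrete g g∈gr) in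
     typeIV-gap-tops X Y ¬Vg (proj₁ g↓p) (predecessor⇒noneBetween X g↓p)) ,
  (λ (a , b , _ , _ , a<b , ¬inv-a , _ , none) _ (_ , V⊆gr) →
     typeIII-gap-bottoms X Y id (λ Va → ¬inv-a (V⊆gr Va)) a<b (noneBetween a b none)) ,
  (λ (a , b , _ , _ , a<b , _ , ¬inv-b , none) _ →
     typeIV-gap-tops X Y ¬inv-b a<b (noneBetween a b none))
  where
    noneBetween : ∀ a b → ¬ (∃[ c ] (⊤ × _<_ X a c × _<_ X c b)) → NoneBetween X a b
    noneBetween a b none (c , a<c , c<b) = none (c , tt , a<c , c<b)
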